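{- Let $N$ be the ordinary net with places $p_1,\dots,p_{12}$ and the following twenty transitions, where "$p_s\to D$ [obs $p_o$]" denotes the transition $t$ with ${}^\bullet t=\{p_s,p_o\}$ and $t^\bullet=D\cup\{p_o\}$ (all edge-weights 1): $t_1: p_1\to\{p_3\}$ [obs $p_2$]; $t_2: p_4\to\{p_6\}$ [obs $p_5$]; $t_3: p_7\to\{p_8\}$ [obs $p_3$]; $t_4: p_8\to\{p_9,p_2\}$ [obs $p_3$]; $t_5: p_9\to\{p_{10},p_2\}$ [obs $p_3$]; $t_6: p_{10}\to\{p_{11}\}$ [obs $p_6$]; $t_7: p_{11}\to\{p_{12},p_5\}$ [obs $p_6$]; $t_8: p_{12}\to\{p_7,p_5\}$ [obs $p_6$]; $t_9: p_1\to\{p_2\}$ [obs $p_7$]; $t_{10}: p_2\to\{p_1\}$ [obs $p_7$]; $t_{11}: p_4\to\{p_5\}$ [obs $p_{10}$]; $t_{12}: p_5\to\{p_4\}$ [obs $p_{10}$]; $t_{13}: p_1\to\emptyset$ [obs $p_{11}$]; $t_{14}: p_1\to\emptyset$ [obs $p_{12}$]; $t_{15}: p_3\to\emptyset$ [obs $p_{11}$]; $t_{16}: p_3\to\emptyset$ [obs $p_{12}$]; $t_{17}: p_4\to\emptyset$ [obs $p_8$]; $t_{18}: p_4\to\emptyset$ [obs $p_9$]; $t_{19}: p_6\to\emptyset$ [obs $p_8$]; $t_{20}: p_6\to\emptyset$ [obs $p_9$]. Then $N$ (an ord-BIO net) is structurally live.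
   Context: A net $N=(P,T,F)$ has finite disjoint $P,T$, $F:(P\times T)\cup(T\times P)\to\mathbb{N}$. ${}^\bullet t(p)=F(p,t)$, $t^\bullet(p)=F(t,p)$. Markings $M:P\to\mathbb{N}$; $t$ is enabled at $M$ if $M\ge{}^\bullet t$; firing gives $M-{}^\bullet t+t^\bullet$. A transition is dead at $M$ if enabled at no marking reachable from $M$, live at $M$ if not dead at any marking reachable from $M$; $M$ is live if all transitions are live at $M$; $N$ is structurally live if some marking of $N$ is live. -}

module Defs where

open import Data.Nat using (ℕ; zero; suc; _+_; _∸_; _≤_)
import Data.Nat
import Data.Fin
import Data.Vec
open import Data.Fin using (Fin; zero; suc; #_)
open import Data.Fin.Properties using (_≟_)
open import Relation.Nullary using (yes; no)
open import Data.Product using (Σ; ∃; _×_; _,_)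
open import Data.List using (List; []; _∷_)
open import Relation.Nullary using (¬_)
open import Relation.Binary.PropositionalEquality using (_≡_)

-- A net with finite place set Fin np and transition set Fin nt
-- (finite, disjoint as separate types), with flow function F split into
-- pre (F(p,t)) and post (F(t,p)).
record Net : Set where
  field
    np  : ℕ
    nt  : ℕ
    pre  : Fin nt → Fin np → ℕ
    post : Fin nt → Fin np → ℕ
open Net public

Marking : Net → Set
Marking N = Fin (np N) → ℕ

Enabled : (N : Net) → Fin (nt N) → Marking N → Set
Enabled N t M = ∀ p → pre N t p ≤ M p

fire : (N : Net) → Fin (nt N) → Marking N → Marking N
fire N t M p = (M p ∸ pre N t p) + post N t p

data Reach (N : Net) : Marking N → Marking N → Set where
  refl  : ∀ {M} → Reach N M M
  step  : ∀ {M M'} (t : Fin (nt N)) → Enabled N t M →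
          Reach N (fire N t M) M' → Reach N M M'

Dead : (N : Net) → Fin (nt N) → Marking N → Set
Dead N t M = ∀ M' → Reach N M M' → ¬ Enabled N t M'

LiveT : (N : Net) → Fin (nt N) → Marking N → Set
LiveT N t M = ∀ M' → Reach N M M' → ¬ Dead N t M'

LiveM : (N : Net) → Marking N → Set
LiveM N M = ∀ t → LiveT N t M

StructurallyLive : Net → Set
StructurallyLive N = Σ (Marking N) (LiveM N)

-- The concrete net of Proposition 6.9.
-- Place p_i is encoded as the element of Fin 12 with index i-1;
-- transition t_j as the element of Fin 20 with index j-1.

ind : List (Fin 12) → Fin 12 → ℕ
ind [] p = 0
ind (q ∷ qs) p with q ≟ p
... | yes _ = suc (ind qs p)
... | no _  = ind qs p

-- "p_s → D [obs p_o]" : pre = {p_s, p_o}, post = D ∪ {p_o}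
-- (p_s ≠ p_o and p_o ∉ D in all instances below, so all weights are 1)
record BIOT : Set where
  constructor _⟶_obs_
  field
    src : Fin 12
    dst : List (Fin 12)
    obs : Fin 12

p1 : Fin 12
p1 = # 0
p2 : Fin 12
p2 = # 1
p3 : Fin 12
p3 = # 2
p4 : Fin 12
p4 = # 3
p5 : Fin 12
p5 = # 4
p6 : Fin 12
p6 = # 5
p7 : Fin 12
p7 = # 6
p8 : Fin 12
p8 = # 7
p9 : Fin 12
p9 = # 8
p10 : Fin 12
p10 = # 9
p11 : Fin 12
p11 = # 10
p12 : Fin 12
p12 = # 11

trans : Fin 20 → BIOT
trans t = Data.Vec.lookup table t
  where
  open import Data.Vec using (Vec; _∷_; [])
  table : Vec BIOT 20
  table =
      (p1  ⟶ (p3 ∷ [])            obs p2)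
    ∷ (p4  ⟶ (p6 ∷ [])            obs p5)
    ∷ (p7  ⟶ (p8 ∷ [])            obs p3)
    ∷ (p8  ⟶ (p9 ∷ p2 ∷ [])      obs p3)
    ∷ (p9  ⟶ (p10 ∷ p2 ∷ [])     obs p3)
    ∷ (p10 ⟶ (p11 ∷ [])           obs p6)
    ∷ (p11 ⟶ (p12 ∷ p5 ∷ [])     obs p6)
    ∷ (p12 ⟶ (p7 ∷ p5 ∷ [])      obs p6)
    ∷ (p1  ⟶ (p2 ∷ [])            obs p7)
    ∷ (p2  ⟶ (p1 ∷ [])            obs p7)
    ∷ (p4  ⟶ (p5 ∷ [])            obs p10)
    ∷ (p5  ⟶ (p4 ∷ [])            obs p10)
    ∷ (p1  ⟶ []                    obs p11)
    ∷ (p1  ⟶ []                    obs p12)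
    ∷ (p3  ⟶ []                    obs p11)
    ∷ (p3  ⟶ []                    obs p12)
    ∷ (p4  ⟶ []                    obs p8)
    ∷ (p4  ⟶ []                    obs p9)
    ∷ (p6  ⟶ []                    obs p8)
    ∷ (p6  ⟶ []                    obs p9)
    ∷ []

N69 : Net
N69 = record
  { np = 12
  ; nt = 20
  ; pre  = λ t → ind (BIOT.src (trans t) ∷ BIOT.obs (trans t) ∷ [])
  ; post = λ t → ind (BIOT.obs (trans t) ∷ BIOT.dst (trans t))
  }

-- The control places p₇ … p₁₂ hold exactly one token, and each position of it comes with
-- lower bounds on the other places (e.g. with the token on p₇: p₁ + p₂ + p₃ ≥ 2, p₅ ≥ 2,
-- p₆ ≥ 1). These sixteen patterns, exact on control places and lower bounds elsewhere,
-- describe a set of markings closed under firing; as firing is monotone it suffices to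
-- check this at the least marking of each pattern enabling a transition. Every pattern
-- leads by a fixed run to a marking above C = p₂² p₅² p₆ p₇, and one run from C enables
-- each transition along the way; monotonicity transfers these runs to all markings above,
-- so from every marking reachable from C every transition can again be enabled.
module Submission where

open import Defs
open import Data.Bool using (Bool; T)
open import Data.Fin using (Fin; zero; toℕ; #_)
open import Data.Fin.Properties using (all?; any?)
open import Data.List using (List; []; _∷_)
open import Data.Nat using (ℕ; _+_; _∸_; _≤_; _⊔_; _≤?_; _≤ᵇ_)
open import Data.Nat.Properties
  using (≤-refl; ≤-trans; ≤-antisym; +-monoˡ-≤; ∸-monoˡ-≤; m≤m⊔n; ⊔-lub)
  renaming (_≟_ to _≟ℕ_)
open import Data.Product using (_×_; _,_; proj₁; proj₂; ∃-syntax)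
open import Data.Sum using (_⊎_; inj₁; inj₂)
open import Data.Vec using (Vec; []; _∷_; lookup)
open import Relation.Binary.PropositionalEquality
  using (_≡_; refl; sym; cong; subst) renaming (trans to ≡-trans)
open import Relation.Nullary using (Dec)
open import Relation.Nullary.Decidable using (T?; _×-dec_; _⊎-dec_; _→-dec_; toWitness)

module NetProperties (N : Net) where

  private variable
    M M′ M₀ L : Marking N
    t : Fin (nt N)

  infix 4 _≤ₘ_
  _≤ₘ_ : Marking N → Marking N → Set
  M ≤ₘ L = ∀ p → M p ≤ L p

  _≤ₘ?_ : (M L : Marking N) → Dec (M ≤ₘ L)
  M ≤ₘ? L = all? (λ p → M p ≤? L p)

  ≤ₘ-trans : M ≤ₘ M′ → M′ ≤ₘ L → M ≤ₘ L
  ≤ₘ-trans M≤M′ M′≤L p = ≤-trans (M≤M′ p) (M′≤L p)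

  enabled? : ∀ t M → Dec (Enabled N t M)
  enabled? t M = pre N t ≤ₘ? M

  enabled-mono : Enabled N t M → M ≤ₘ L → Enabled N t L
  enabled-mono = ≤ₘ-trans

  fire-mono : M ≤ₘ L → fire N t M ≤ₘ fire N t L
  fire-mono {t = t} M≤L p = +-monoˡ-≤ (post N t p) (∸-monoˡ-≤ (pre N t p) (M≤L p))

  reach-trans : Reach N M M′ → Reach N M′ L → Reach N M L
  reach-trans refl         r′ = r′
  reach-trans (step t e r) r′ = step t e (reach-trans r r′)

  reach-mono : Reach N M M′ → M ≤ₘ L → ∃[ L′ ] Reach N L L′ × M′ ≤ₘ L′
  reach-mono refl M≤L = _ , refl , M≤L
  reach-mono (step t e r) M≤L with reach-mono r (fire-mono M≤L)
  ... | L′ , r′ , M′≤L′ = L′ , step t (enabled-mono e M≤L) r′ , M′≤L′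

  reach-preserves : {P : Marking N → Set} →
                    (∀ {M} t → Enabled N t M → P M → P (fire N t M)) →
                    Reach N M M′ → P M → P M′
  reach-preserves closed refl         PM = PM
  reach-preserves closed (step t e r) PM = reach-preserves closed r (closed t e PM)

  Visits : List (Fin (nt N)) → Marking N → (Marking N → Set) → Set
  Visits []       M Q = Q M
  Visits (u ∷ us) M Q = Q M ⊎ (Enabled N u M × Visits us (fire N u M) Q)

  visits? : {Q : Marking N → Set} → (∀ M → Dec (Q M)) → ∀ us M → Dec (Visits us M Q)
  visits? Q? []       M = Q? M
  visits? Q? (u ∷ us) M = Q? M ⊎-dec (enabled? u M ×-dec visits? Q? us (fire N u M))

  visits⇒reach : {Q : Marking N → Set} → ∀ us → Visits us M Q → ∃[ M′ ] Reach N M M′ × Q M′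
  visits⇒reach []       QM              = _ , refl , QM
  visits⇒reach (u ∷ us) (inj₁ QM)       = _ , refl , QM
  visits⇒reach (u ∷ us) (inj₂ (e , vs)) with visits⇒reach us vs
  ... | M′ , r , QM′ = M′ , step u e r , QM′

  reach-above : ∀ us → Visits us M (M₀ ≤ₘ_) → M ≤ₘ L → ∃[ L′ ] Reach N L L′ × M₀ ≤ₘ L′
  reach-above us vs M≤L with visits⇒reach us vs
  ... | M′ , r , M₀≤M′ with reach-mono r M≤L
  ... | L′ , r′ , M′≤L′ = L′ , r′ , ≤ₘ-trans M₀≤M′ M′≤L′

  home⇒live : (P : Marking N → Set) →
              (∀ {M} t → Enabled N t M → P M → P (fire N t M)) →
              (∀ {M} → P M → ∃[ M′ ] Reach N M M′ × M₀ ≤ₘ M′) →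
              (∀ t → ∃[ M′ ] Reach N M₀ M′ × Enabled N t M′) →
              P M₀ → LiveM N M₀
  home⇒live P closed home enables PM₀ t M r dead
    with home (reach-preserves closed r PM₀)
  ... | M₁ , r₁ , M₀≤M₁ with enables t
  ... | M₂ , r₂ , e₂ with reach-mono r₂ M₀≤M₁
  ... | M₃ , r₃ , M₂≤M₃ = dead M₃ (reach-trans r₁ r₃) (enabled-mono e₂ M₂≤M₃)

module Patterns (N : Net) (frozen : Fin (np N) → Bool) where

  open NetProperties N

  private variable
    k : ℕ
    M : Marking N
    t : Fin (nt N)

  infix 4 _≼_ _≼?_ _∈↑_
  infixl 6 _⊔ₘ_
  _≼_ : Marking N → Marking N → Set
  b ≼ M = b ≤ₘ M × (∀ p → T (frozen p) → M p ≡ b p)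

  _≼?_ : (b M : Marking N) → Dec (b ≼ M)
  b ≼? M = b ≤ₘ? M ×-dec all? (λ p → T? (frozen p) →-dec M p ≟ℕ b p)

  _⊔ₘ_ : Marking N → Marking N → Marking N
  (M ⊔ₘ L) p = M p ⊔ L p

  _∈↑_ : Marking N → (Fin k → Marking N) → Set
  M ∈↑ B = ∃[ i ] B i ≼ M

  -- B i ⊔ₘ pre N t is the least marking above B i enabling t; the premise discards t
  -- when it needs more tokens on a frozen place than B i holds.
  StepClosed : (Fin k → Marking N) → Set
  StepClosed B = ∀ i t → B i ≼ B i ⊔ₘ pre N t → fire N t (B i ⊔ₘ pre N t) ∈↑ B

  stepClosed? : (B : Fin k → Marking N) → Dec (StepClosed B)
  stepClosed? B = all? λ i → all? λ t →
    B i ≼? B i ⊔ₘ pre N t →-dec any? λ j → B j ≼? fire N t (B i ⊔ₘ pre N t)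

  ∈↑-fire : {B : Fin k → Marking N} → StepClosed B → Enabled N t M → M ∈↑ B → fire N t M ∈↑ B
  ∈↑-fire {t = t} {M} {B} closed e (i , b≤M , M≡b) = lift (closed i t (b≤m , m≡b))
    where
    m : Marking N
    m = B i ⊔ₘ pre N t
    b≤m : B i ≤ₘ m
    b≤m p = m≤m⊔n (B i p) (pre N t p)
    m≤M : m ≤ₘ M
    m≤M p = ⊔-lub (b≤M p) (e p)
    M≡m : ∀ p → T (frozen p) → M p ≡ m p
    M≡m p f = ≤-antisym (subst (_≤ m p) (sym (M≡b p f)) (b≤m p)) (m≤M p)
    m≡b : ∀ p → T (frozen p) → m p ≡ B i p
    m≡b p f = ≡-trans (sym (M≡m p f)) (M≡b p f)
    lift : fire N t m ∈↑ B → fire N t M ∈↑ B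
    lift (j , b′≤fm , fm≡b′) = j , ≤ₘ-trans b′≤fm (fire-mono m≤M) , λ p f →
      ≡-trans (cong (λ x → x ∸ pre N t p + post N t p) (M≡m p f)) (fm≡b′ p f)

-- The cycle t₃ … t₈ moves a single token around p₇ … p₁₂.
control : Fin 12 → Bool
control p = 6 ≤ᵇ toℕ p

open NetProperties N69
open Patterns N69 control

-- Transition tⱼ is # (j ∸ 1).
basisWithHomeRuns : Vec (Vec ℕ 12 × List (Fin 20)) 16
basisWithHomeRuns =
      (0 ∷ 2 ∷ 0 ∷ 0 ∷ 2 ∷ 1 ∷ 1 ∷ 0 ∷ 0 ∷ 0 ∷ 0 ∷ 0 ∷ [] , [])
    ∷ (2 ∷ 0 ∷ 0 ∷ 0 ∷ 2 ∷ 1 ∷ 1 ∷ 0 ∷ 0 ∷ 0 ∷ 0 ∷ 0 ∷ [] , # 8 ∷ # 8 ∷ [])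
    ∷ (1 ∷ 1 ∷ 0 ∷ 0 ∷ 2 ∷ 1 ∷ 1 ∷ 0 ∷ 0 ∷ 0 ∷ 0 ∷ 0 ∷ [] , # 8 ∷ [])
    ∷ (1 ∷ 0 ∷ 1 ∷ 0 ∷ 2 ∷ 1 ∷ 1 ∷ 0 ∷ 0 ∷ 0 ∷ 0 ∷ 0 ∷ [] , # 2 ∷ # 3 ∷ # 4 ∷ # 5 ∷ # 6 ∷ # 7 ∷ [])
    ∷ (0 ∷ 1 ∷ 1 ∷ 0 ∷ 2 ∷ 1 ∷ 1 ∷ 0 ∷ 0 ∷ 0 ∷ 0 ∷ 0 ∷ [] , # 2 ∷ # 3 ∷ # 4 ∷ # 5 ∷ # 6 ∷ # 7 ∷ [])
    ∷ (0 ∷ 0 ∷ 2 ∷ 0 ∷ 2 ∷ 1 ∷ 1 ∷ 0 ∷ 0 ∷ 0 ∷ 0 ∷ 0 ∷ [] , # 2 ∷ # 3 ∷ # 4 ∷ # 5 ∷ # 6 ∷ # 7 ∷ [])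
    ∷ (0 ∷ 0 ∷ 1 ∷ 0 ∷ 2 ∷ 0 ∷ 0 ∷ 1 ∷ 0 ∷ 0 ∷ 0 ∷ 0 ∷ [] , # 3 ∷ # 4 ∷ # 11 ∷ # 1 ∷ # 5 ∷ # 6 ∷ # 7 ∷ [])
    ∷ (0 ∷ 1 ∷ 1 ∷ 0 ∷ 2 ∷ 0 ∷ 0 ∷ 0 ∷ 1 ∷ 0 ∷ 0 ∷ 0 ∷ [] , # 4 ∷ # 11 ∷ # 1 ∷ # 5 ∷ # 6 ∷ # 7 ∷ [])
    ∷ (0 ∷ 2 ∷ 1 ∷ 2 ∷ 0 ∷ 0 ∷ 0 ∷ 0 ∷ 0 ∷ 1 ∷ 0 ∷ 0 ∷ [] , # 10 ∷ # 1 ∷ # 5 ∷ # 6 ∷ # 7 ∷ [])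
    ∷ (0 ∷ 2 ∷ 1 ∷ 1 ∷ 1 ∷ 0 ∷ 0 ∷ 0 ∷ 0 ∷ 1 ∷ 0 ∷ 0 ∷ [] , # 1 ∷ # 5 ∷ # 6 ∷ # 7 ∷ [])
    ∷ (0 ∷ 2 ∷ 1 ∷ 1 ∷ 0 ∷ 1 ∷ 0 ∷ 0 ∷ 0 ∷ 1 ∷ 0 ∷ 0 ∷ [] , # 5 ∷ # 6 ∷ # 7 ∷ [])
    ∷ (0 ∷ 2 ∷ 1 ∷ 0 ∷ 2 ∷ 0 ∷ 0 ∷ 0 ∷ 0 ∷ 1 ∷ 0 ∷ 0 ∷ [] , # 11 ∷ # 1 ∷ # 5 ∷ # 6 ∷ # 7 ∷ [])
    ∷ (0 ∷ 2 ∷ 1 ∷ 0 ∷ 1 ∷ 1 ∷ 0 ∷ 0 ∷ 0 ∷ 1 ∷ 0 ∷ 0 ∷ [] , # 5 ∷ # 6 ∷ # 7 ∷ [])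
    ∷ (0 ∷ 2 ∷ 1 ∷ 0 ∷ 0 ∷ 2 ∷ 0 ∷ 0 ∷ 0 ∷ 1 ∷ 0 ∷ 0 ∷ [] , # 5 ∷ # 6 ∷ # 7 ∷ [])
    ∷ (0 ∷ 2 ∷ 0 ∷ 0 ∷ 0 ∷ 1 ∷ 0 ∷ 0 ∷ 0 ∷ 0 ∷ 1 ∷ 0 ∷ [] , # 6 ∷ # 7 ∷ [])
    ∷ (0 ∷ 2 ∷ 0 ∷ 0 ∷ 1 ∷ 1 ∷ 0 ∷ 0 ∷ 0 ∷ 0 ∷ 0 ∷ 1 ∷ [] , # 7 ∷ [])
    ∷ []

basis : Fin 16 → Marking N69
basis i = lookup (proj₁ (lookup basisWithHomeRuns i))

homeRun : Fin 16 → List (Fin 20)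
homeRun i = proj₂ (lookup basisWithHomeRuns i)

C : Marking N69
C = basis zero

coveringRun : List (Fin 20)
coveringRun = # 9 ∷ # 0 ∷ # 9 ∷ # 2 ∷ # 3 ∷ # 4 ∷ # 11 ∷ # 5 ∷ # 6 ∷ # 7 ∷ # 2 ∷ # 3 ∷ []

basis-closed : StepClosed basis
basis-closed = toWitness {a? = stepClosed? basis} _

basis-home : ∀ i → Visits (homeRun i) (basis i) (C ≤ₘ_)
basis-home = toWitness {a? = all? λ i → visits? (C ≤ₘ?_) (homeRun i) (basis i)} _

coveringRun-enables : ∀ t → Visits coveringRun C (Enabled N69 t)
coveringRun-enables = toWitness {a? = all? λ t → visits? (enabled? t) coveringRun C} _

C∈↑basis : C ∈↑ basis
C∈↑basis = zero , (λ p → ≤-refl) , λ p _ → refl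

proposition6p9 : StructurallyLive N69
proposition6p9 = C , home⇒live (_∈↑ basis) (λ t → ∈↑-fire {t = t} basis-closed)
                               home enables C∈↑basis
  where
  home : ∀ {M} → M ∈↑ basis → ∃[ M′ ] Reach N69 M M′ × C ≤ₘ M′
  home (i , b≤M , _) = reach-above (homeRun i) (basis-home i) b≤M

  enables : ∀ t → ∃[ M′ ] Reach N69 C M′ × Enabled N69 t M′
  enables t = visits⇒reach coveringRun (coveringRun-enables t)
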